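{- Let $f$ be a permutation of $\mathbb{Q}$, let $k\ge 1$, and let $a_1<\dots<a_k$ and $b_1<\dots<b_k$ be rational numbers such that (i) $f(a_1)<f(a_2)<\dots<f(a_k)$ and $f(b_1)>f(b_2)>\dots>f(b_k)$; (ii) $[a_1,a_k]\cap[b_1,b_k]=\emptyset$ and $[f(a_1),f(a_k)]\cap[f(b_k),f(b_1)]=\emptyset$. Then $f$ is $k$-trivial, i.e. the group $\Gamma_f$ realizes every permutation of $\{1,\dots,k\}$.
   Context: A shift is a monotonically increasing permutation of $\mathbb{Q}$; $\Gamma$ is the group of all shifts, and for a permutation $f$ of $\mathbb{Q}$, $\Gamma_f$ is the group of permutations of $\mathbb{Q}$ generated by $\Gamma\cup\{f\}$. For a tuple $(x_1,\dots,x_k)$ of distinct rationals its pattern is the permutation $\sigma$ of $\{1,\dots,k\}$ with $\sigma(i)=|\{j: x_j\le x_i\}|$. A set $G$ of permutations of $\mathbb{Q}$ realizes a permutation $\sigma$ of $\{1,\dots,k\}$ if there are $g\in G$ and rationals $a_1<\dots<a_k$ such that the pattern of $(g(a_1),\dots,g(a_k))$ is $\sigma$. The permutation $f$ is $k$-nontrivial if $\Gamma_f$ does not realize every permutation of $\{1,\dots,k\}$, and $k$-trivial otherwise. -}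

module Defs where

open import Level using (0ℓ)
open import Data.Nat using (ℕ; suc)
open import Data.Fin using (Fin; toℕ)
import Data.Fin as F
open import Data.List using (length; filter; allFin)
open import Data.Rational using (ℚ; _≤_; _<_; _≤?_)
open import Data.Product using (Σ; ∃; _×_)
open import Relation.Binary.PropositionalEquality using (_≡_)
open import Function using (_↔_; Inverse)
open import Function.Construct.Identity using (↔-id)
open import Function.Construct.Composition using (_↔-∘_)
open import Function.Construct.Symmetry using (↔-sym)
open import Data.Fin.Permutation using (Permutation′; _⟨$⟩ʳ_)

PermQ : Set
PermQ = ℚ ↔ ℚ

app : PermQ → ℚ → ℚ
app g = Inverse.to g

IsShift : PermQ → Set
IsShift g = ∀ x y → x < y → app g x < app g y

data InΓ (f : PermQ) : PermQ → Set where
  shift : ∀ g → IsShift g → InΓ f g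
  gen   : InΓ f f
  idp   : InΓ f (↔-id ℚ)
  comp  : ∀ {g h} → InΓ f g → InΓ f h → InΓ f (g ↔-∘ h)
  inv   : ∀ {g} → InΓ f g → InΓ f (↔-sym g)

countLe : ∀ {k} → (Fin k → ℚ) → Fin k → ℕ
countLe {k} x i = length (filter (λ j → x j ≤? x i) (allFin k))

-- The pattern of the tuple x is σ (σ viewed on {1..k} via toℕ + 1):
-- σ(i) = |{ j : x_j ≤ x_i }| for all i.
HasPattern : ∀ {k} → (Fin k → ℚ) → Permutation′ k → Set
HasPattern x σ = ∀ i → suc (toℕ (σ ⟨$⟩ʳ i)) ≡ countLe x i

StrictlyIncreasing : ∀ {k} → (Fin k → ℚ) → Set
StrictlyIncreasing a = ∀ i j → i F.< j → a i < a j

StrictlyDecreasing : ∀ {k} → (Fin k → ℚ) → Set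
StrictlyDecreasing a = ∀ i j → i F.< j → a j < a i

Realizes : (PermQ → Set) → ∀ {k} → Permutation′ k → Set
Realizes G {k} σ = Σ PermQ λ g → G g × Σ (Fin k → ℚ) λ a →
  StrictlyIncreasing a × HasPattern (λ i → app g (a i)) σ

KTrivial : ℕ → PermQ → Set
KTrivial k f = (σ : Permutation′ k) → Realizes (InΓ f) σ

DisjointIntervals : ℚ → ℚ → ℚ → ℚ → Set
DisjointIntervals p q r s = ∀ x → p ≤ x → x ≤ q → r ≤ x → x ≤ s → ⊥'
  where open import Data.Empty renaming (⊥ to ⊥')

module Submission where

open import Defs
open import Data.Nat as ℕ using (ℕ; zero; suc)
import Data.Nat.Properties as ℕₚ
open import Data.Fin as Fin using (Fin; zero; suc; toℕ; fromℕ; fromℕ<; opposite)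
open import Data.Fin.Properties using (toℕ-injective; toℕ<n; toℕ-fromℕ<; ≤fromℕ; opposite-prop; opposite-involutive; _≟_; <-cmp)
open import Data.Fin.Permutation using (Permutation′; permutation; _⟨$⟩ʳ_; _⟨$⟩ˡ_; _∘ₚ_; flip; _≈_; id; reverse; transpose; inverseˡ; inverseʳ)
import Data.Fin.Permutation.Components as PC
open import Data.Fin.Permutation.Transposition.List using (eval; decompose; eval-decompose)
open import Data.List using ([]; _∷_; length; filter; tabulate)
open import Data.Rational using (ℚ; _<_; _≤_; _<?_; _≤?_)
open import Data.Rational.Properties using (<⇒≤; ≤-refl; ≤-trans; ≤-total; ≮⇒≥; <-irrefl; <-≤-trans; ≤-<-trans)
open import Data.Product using (Σ; _×_; _,_; proj₁; proj₂)
open import Data.Sum using (_⊎_; inj₁; inj₂)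
open import Data.Empty using (⊥-elim)
open import Relation.Nullary using (Dec; yes; no; ¬_; contradiction)
open import Relation.Binary.Definitions using (tri<; tri≈; tri>)
open import Relation.Binary.PropositionalEquality
open import Function using (Inverse; _∘_; case_of_)
open import Function.Construct.Composition using (_↔-∘_)
open import Function.Construct.Identity using (↔-id)
open import Function.Construct.Symmetry using (↔-sym)
open import Algebra.Properties.CommutativeMonoid.Sum ℕₚ.+-0-commutativeMonoid
  using (sum; sum-cong-≗; sum-permute; sum-replicate-zero)

module Shifts where

  open import Data.Rational
  open import Data.Rational.Properties
  open import Data.Rational.Solver using (module +-*-Solver)
  open import Function using (mk↔ₛ′)
  open +-*-Solver

  Carries : ∀ {k} → PermQ → (Fin k → ℚ) → (Fin k → ℚ) → Set
  Carries g c e = ∀ i → app g (c i) ≡ e i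

  shift-∘ : ∀ g h → IsShift g → IsShift h → IsShift (g ↔-∘ h)
  shift-∘ g h g↑ h↑ x y x<y = g↑ _ _ (h↑ _ _ x<y)

  difference-negative : ∀ {x p} → x < p → x - p < 0ℚ
  difference-negative {x} {p} x<p = subst (x - p <_) (+-inverseʳ p) (+-monoˡ-< (- p) x<p)

  difference-positive : ∀ {x p} → x < p → 0ℚ < p - x
  difference-positive {x} {p} x<p = subst (_< p - x) (+-inverseʳ x) (+-monoˡ-< (- x) x<p)

  translation : ℚ → PermQ
  translation d = mk↔ₛ′ (_+ d) (_- d)
    (λ x → solve 2 (λ x d → (x :- d) :+ d := x) refl x d)
    (λ x → solve 2 (λ x d → (x :+ d) :- d := x) refl x d)

  translation-shift : ∀ d → IsShift (translation d)
  translation-shift d x y = +-monoˡ-< d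

  pivotMap : ℚ → ℚ → ℚ → ℚ
  pivotMap p α x with p ≤? x
  ... | yes _ = x
  ... | no _  = p + α * (x - p)

  pivotMap-above : ∀ p α {x} → p ≤ x → pivotMap p α x ≡ x
  pivotMap-above p α {x} p≤x with p ≤? x
  ... | yes _   = refl
  ... | no p≰x = ⊥-elim (p≰x p≤x)

  pivotMap-below : ∀ p α {x} → x < p → pivotMap p α x ≡ p + α * (x - p)
  pivotMap-below p α {x} x<p with p ≤? x
  ... | yes p≤x = ⊥-elim (<-irrefl refl (<-≤-trans x<p p≤x))
  ... | no _    = refl

  affine-below : ∀ p α .{{_ : Positive α}} {x} → x < p → p + α * (x - p) < p
  affine-below p α {x} x<p = begin-strict
    p + α * (x - p) <⟨ +-monoʳ-< p (*-monoʳ-<-pos α (difference-negative x<p)) ⟩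
    p + α * 0ℚ      ≡⟨ solve 2 (λ p α → p :+ α :* con 0ℚ := p) refl p α ⟩
    p               ∎
    where open ≤-Reasoning

  pivotMap-increasing : ∀ p α .{{_ : Positive α}} x y → x < y → pivotMap p α x < pivotMap p α y
  pivotMap-increasing p α x y x<y with p ≤? x | p ≤? y
  ... | yes _   | yes _   = x<y
  ... | no p≰x  | yes p≤y = <-≤-trans (affine-below p α (≰⇒> p≰x)) p≤y
  ... | yes p≤x | no p≰y  = ⊥-elim (p≰y (<⇒≤ (≤-<-trans p≤x x<y)))
  ... | no _    | no _    = +-monoʳ-< p (*-monoʳ-<-pos α (+-monoˡ-< (- p) x<y))

  pivotMap-inverse : ∀ p α .{{_ : Positive α}} x →
    pivotMap p ((1/ α) {{pos⇒nonZero α}}) (pivotMap p α x) ≡ x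
  pivotMap-inverse p α x with p ≤? x
  ... | yes p≤x = pivotMap-above p _ p≤x
  ... | no p≰x  = begin
    pivotMap p α⁻¹ (p + α * (x - p))   ≡⟨ pivotMap-below p α⁻¹ (affine-below p α (≰⇒> p≰x)) ⟩
    p + α⁻¹ * (p + α * (x - p) - p)    ≡⟨ cong (λ z → p + α⁻¹ * z) (solve 2 (λ p w → (p :+ w) :- p := w) refl p (α * (x - p))) ⟩
    p + α⁻¹ * (α * (x - p))            ≡⟨ cong (p +_) (sym (*-assoc α⁻¹ α (x - p))) ⟩
    p + (α⁻¹ * α) * (x - p)            ≡⟨ cong (λ z → p + z * (x - p)) (*-inverseˡ α {{pos⇒nonZero α}}) ⟩
    p + 1ℚ * (x - p)                   ≡⟨ solve 2 (λ p x → p :+ (con 1ℚ :* (x :- p)) := x) refl p x ⟩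
    x                                  ∎
    where
    open ≡-Reasoning
    α⁻¹ : ℚ
    α⁻¹ = (1/ α) {{pos⇒nonZero α}}

  pivot : ∀ p α .{{_ : Positive α}} → PermQ
  pivot p α = mk↔ₛ′ (pivotMap p α) (pivotMap p α⁻¹) right-inverse (pivotMap-inverse p α)
    where
    α⁻¹ : ℚ
    α⁻¹ = (1/ α) {{pos⇒nonZero α}}
    right-inverse : ∀ x → pivotMap p α (pivotMap p α⁻¹ x) ≡ x
    right-inverse x = subst (λ β → pivotMap p β (pivotMap p α⁻¹ x) ≡ x)
      (1/-involutive α {{pos⇒nonZero α}}) (pivotMap-inverse p α⁻¹ {{1/pos⇒pos α}} x)

  pivot-shift : ∀ p α .{{_ : Positive α}} → IsShift (pivot p α)
  pivot-shift p α = pivotMap-increasing p α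

  module PivotThrough (p q r : ℚ) (q<p : q < p) (r<p : r < p) where
    private
      instance
        p-q-pos : Positive (p - q)
        p-q-pos = positive (difference-positive q<p)
        p-r-pos : Positive (p - r)
        p-r-pos = positive (difference-positive r<p)
        p-q-nonZero : NonZero (p - q)
        p-q-nonZero = pos⇒nonZero (p - q)

    slope : ℚ
    slope = (p - r) * 1/ (p - q)

    instance
      slope-pos : Positive slope
      slope-pos = pos*pos⇒pos (p - r) (1/ (p - q)) {{1/pos⇒pos (p - q)}}

    sends : pivotMap p slope q ≡ r
    sends = begin
      pivotMap p slope q                        ≡⟨ pivotMap-below p slope q<p ⟩
      p + (p - r) * w * (q - p)                 ≡⟨ solve 4 (λ p q r w → p :+ (p :- r) :* w :* (q :- p) := p :- (p :- r) :* (w :* (p :- q))) refl p q r w ⟩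
      p - (p - r) * (w * (p - q))               ≡⟨ cong (λ z → p - (p - r) * z) (*-inverseˡ (p - q)) ⟩
      p - (p - r) * 1ℚ                          ≡⟨ solve 2 (λ p r → p :- (p :- r) :* con 1ℚ := r) refl p r ⟩
      r                                         ∎
      where
      open ≡-Reasoning
      w : ℚ
      w = 1/ (p - q)

  -- Induction on the length: first carry the tail,
  -- then pivot at the new position of the second point to place the first.
  shift-interpolation : ∀ m (c e : Fin (suc m) → ℚ) → StrictlyIncreasing c → StrictlyIncreasing e →
    Σ PermQ λ s → IsShift s × Carries s c e
  shift-interpolation zero c e _ _ =
    translation (e zero - c zero) , translation-shift _ ,
    λ { zero → solve 2 (λ c e → c :+ (e :- c) := e) refl (c zero) (e zero) }
  shift-interpolation (suc m) c e c↑ e↑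
    with shift-interpolation m (λ i → c (suc i)) (λ i → e (suc i))
           (λ i j i<j → c↑ (suc i) (suc j) (ℕ.s≤s i<j)) (λ i j i<j → e↑ (suc i) (suc j) (ℕ.s≤s i<j))
  ... | s , s↑ , s-carries = pivot p slope ↔-∘ s , shift-∘ (pivot p slope) s (pivot-shift p slope) s↑ , carries
    where
    p q : ℚ
    p = e (suc zero)
    q = app s (c zero)
    q<p : q < p
    q<p = subst (q <_) (s-carries zero) (s↑ _ _ (c↑ zero (suc zero) (ℕ.s≤s ℕ.z≤n)))
    open PivotThrough p q (e zero) q<p (e↑ zero (suc zero) (ℕ.s≤s ℕ.z≤n))
    carries : Carries (pivot p slope ↔-∘ s) c e
    carries zero    = sends
    carries (suc i) = trans (cong (pivotMap p slope) (s-carries i)) (pivotMap-above p slope (e-above i))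
      where
      e-above : ∀ i → p ≤ e (suc i)
      e-above zero    = ≤-refl
      e-above (suc i) = <⇒≤ (e↑ (suc zero) (suc (suc i)) (ℕ.s≤s (ℕ.s≤s ℕ.z≤n)))

open Shifts

data Direction : Set where
  ascending descending : Direction

turn : Direction → Direction
turn ascending  = descending
turn descending = ascending

Ordered : Direction → ℚ → ℚ → Set
Ordered ascending  x y = x < y
Ordered descending x y = y < x

ordered-turn : ∀ d {x y} → Ordered (turn d) x y → Ordered d y x
ordered-turn ascending  x>y = x>y
ordered-turn descending x<y = x<y

-- Strictly monotone tuples; Monotone ascending is StrictlyIncreasing and
-- Monotone descending is StrictlyDecreasing, definitionally.
Monotone : ∀ {k} → Direction → (Fin k → ℚ) → Set
Monotone d x = ∀ i j → i Fin.< j → Ordered d (x i) (x j)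

opposite-reverses : ∀ {k} {i j : Fin k} → i Fin.< j → opposite j Fin.< opposite i
opposite-reverses {i = i} {j} i<j = subst₂ ℕ._<_ (sym (opposite-prop j)) (sym (opposite-prop i))
  (ℕₚ.∸-monoʳ-< (ℕ.s≤s i<j) (toℕ<n j))

monotone-backwards : ∀ {k} d {x : Fin k → ℚ} → Monotone d x → Monotone (turn d) (λ i → x (opposite i))
monotone-backwards ascending  x↑ i j i<j = x↑ _ _ (opposite-reverses i<j)
monotone-backwards descending x↓ i j i<j = x↓ _ _ (opposite-reverses i<j)

shift-between : ∀ {m} d (c e : Fin (suc m) → ℚ) → Monotone d c → Monotone d e →
  Σ PermQ λ s → IsShift s × Carries s c e
shift-between ascending c e c↑ e↑ = shift-interpolation _ c e c↑ e↑
shift-between descending c e c↓ e↓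
  with shift-interpolation _ (λ i → c (opposite i)) (λ i → e (opposite i))
         (monotone-backwards descending c↓) (monotone-backwards descending e↓)
... | s , s↑ , s-carries = s , s↑ ,
  λ i → subst (λ j → app s (c j) ≡ e j) (opposite-involutive i) (s-carries (opposite i))

ascending-≤ : ∀ {k} {x : Fin k → ℚ} → StrictlyIncreasing x → ∀ {i j} → i Fin.≤ j → x i ≤ x j
ascending-≤ x↑ i≤j with ℕₚ.m≤n⇒m<n∨m≡n i≤j
... | inj₁ i<j = <⇒≤ (x↑ _ _ i<j)
... | inj₂ i≡j rewrite toℕ-injective i≡j = ≤-refl

descending-≤ : ∀ {k} {x : Fin k → ℚ} → StrictlyDecreasing x → ∀ {i j} → i Fin.≤ j → x j ≤ x i
descending-≤ x↓ i≤j with ℕₚ.m≤n⇒m<n∨m≡n i≤j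
... | inj₁ i<j = <⇒≤ (x↓ _ _ i<j)
... | inj₂ i≡j rewrite toℕ-injective i≡j = ≤-refl

Within : ∀ {k} → ℚ → ℚ → (Fin k → ℚ) → Set
Within l h x = ∀ p → l ≤ x p × x p ≤ h

ascending-within : ∀ {n} {x : Fin (suc n) → ℚ} → StrictlyIncreasing x → Within (x zero) (x (fromℕ n)) x
ascending-within x↑ p = ascending-≤ x↑ ℕ.z≤n , ascending-≤ x↑ (≤fromℕ p)

descending-within : ∀ {n} {x : Fin (suc n) → ℚ} → StrictlyDecreasing x → Within (x (fromℕ n)) (x zero) x
descending-within x↓ p = descending-≤ x↓ (≤fromℕ p) , descending-≤ x↓ ℕ.z≤n

separated : ∀ {m k} {l₁ h₁ l₂ h₂} {x : Fin (suc m) → ℚ} {y : Fin (suc k) → ℚ} →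
  Within l₁ h₁ x → Within l₂ h₂ y → DisjointIntervals l₁ h₁ l₂ h₂ →
  (∀ p q → x p < y q) ⊎ (∀ p q → y q < x p)
separated {l₁ = l₁} {h₁} {l₂} {h₂} x∈ y∈ disjoint with h₁ <? l₂ | h₂ <? l₁
... | yes h₁<l₂ | _         = inj₁ λ p q → ≤-<-trans (proj₂ (x∈ p)) (<-≤-trans h₁<l₂ (proj₁ (y∈ q)))
... | no _      | yes h₂<l₁ = inj₂ λ p q → ≤-<-trans (proj₂ (y∈ q)) (<-≤-trans h₂<l₁ (proj₁ (x∈ p)))
... | no h₁≮l₂  | no h₂≮l₁  with ≤-total l₁ l₂
...   | inj₁ l₁≤l₂ = ⊥-elim (disjoint l₂ l₁≤l₂ (≮⇒≥ h₁≮l₂) ≤-refl l₂≤h₂)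
  where l₂≤h₂ = ≤-trans (proj₁ (y∈ zero)) (proj₂ (y∈ zero))
...   | inj₂ l₂≤l₁ = ⊥-elim (disjoint l₁ ≤-refl l₁≤h₁ l₂≤l₁ (≮⇒≥ h₂≮l₁))
  where l₁≤h₁ = ≤-trans (proj₁ (x∈ zero)) (proj₂ (x∈ zero))

splice : ∀ {k} → ℕ → (Fin k → ℚ) → (Fin k → ℚ) → Fin k → ℚ
splice j u v p with toℕ p ℕₚ.<? j
... | yes _ = u p
... | no _  = v p

splice-below : ∀ {k} j (u v : Fin k → ℚ) {p} → toℕ p ℕ.< j → splice j u v p ≡ u p
splice-below j u v {p} p<j with toℕ p ℕₚ.<? j
... | yes _   = refl
... | no p≮j = ⊥-elim (p≮j p<j)

splice-above : ∀ {k} j (u v : Fin k → ℚ) {p} → j ℕ.≤ toℕ p → splice j u v p ≡ v p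
splice-above j u v {p} j≤p with toℕ p ℕₚ.<? j
... | yes p<j = ⊥-elim (ℕₚ.<⇒≱ p<j j≤p)
... | no _    = refl

monotone-by-cut : ∀ {k} d j (y : Fin k → ℚ) →
  (∀ p q → p Fin.< q → toℕ q ℕ.< j → Ordered d (y p) (y q)) →
  (∀ p q → toℕ p ℕ.< j → j ℕ.≤ toℕ q → Ordered d (y p) (y q)) →
  (∀ p q → p Fin.< q → j ℕ.≤ toℕ p → Ordered d (y p) (y q)) →
  Monotone d y
monotone-by-cut d j y below across above p q p<q with toℕ q ℕₚ.<? j | toℕ p ℕₚ.<? j
... | yes q<j | _         = below p q p<q q<j
... | no q≮j  | yes p<j  = across p q p<j (ℕₚ.≮⇒≥ q≮j)
... | no _    | no p≮j   = above p q p<q (ℕₚ.≮⇒≥ p≮j)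

monotone-splice : ∀ {k} d j {u v : Fin k → ℚ} → Monotone d u → Monotone d v →
  (∀ p q → Ordered d (u p) (v q)) → Monotone d (splice j u v)
monotone-splice d j {u} {v} u↗ v↗ u↗v = monotone-by-cut d j (splice j u v)
  (λ p q p<q q<j → subst₂ (Ordered d) (sym (splice-below j u v (ℕₚ.<-trans p<q q<j))) (sym (splice-below j u v q<j))
                     (u↗ p q p<q))
  (λ p q p<j j≤q → subst₂ (Ordered d) (sym (splice-below j u v p<j)) (sym (splice-above j u v j≤q)) (u↗v p q))
  (λ p q p<q j≤p → subst₂ (Ordered d) (sym (splice-above j u v j≤p))
                     (sym (splice-above j u v (ℕₚ.≤-trans j≤p (ℕₚ.<⇒≤ p<q)))) (v↗ p q p<q))

-- x has order type σ: listing the entries of x in the order given by σ yields an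
-- increasing tuple, i.e. x i < x j exactly when σ i < σ j.
HasOrderType : ∀ {k} → (Fin k → ℚ) → Permutation′ k → Set
HasOrderType x σ = StrictlyIncreasing (λ m → x (σ ⟨$⟩ˡ m))

hasOrderType-cong : ∀ {k} {x y : Fin k → ℚ} σ → (∀ i → x i ≡ y i) → HasOrderType x σ → HasOrderType y σ
hasOrderType-cong σ x≗y x↑ m m′ m<m′ = subst₂ _<_ (x≗y (σ ⟨$⟩ˡ m)) (x≗y (σ ⟨$⟩ˡ m′)) (x↑ m m′ m<m′)

inverse-cong : ∀ {k} (σ τ : Permutation′ k) → σ ≈ τ → ∀ m → τ ⟨$⟩ˡ m ≡ σ ⟨$⟩ˡ m
inverse-cong σ τ σ≈τ m = begin
  τ ⟨$⟩ˡ m                    ≡⟨ inverseˡ σ ⟨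
  σ ⟨$⟩ˡ (σ ⟨$⟩ʳ (τ ⟨$⟩ˡ m))  ≡⟨ cong (σ ⟨$⟩ˡ_) (σ≈τ (τ ⟨$⟩ˡ m)) ⟩
  σ ⟨$⟩ˡ (τ ⟨$⟩ʳ (τ ⟨$⟩ˡ m))  ≡⟨ cong (σ ⟨$⟩ˡ_) (inverseʳ τ) ⟩
  σ ⟨$⟩ˡ m                    ∎
  where open ≡-Reasoning

hasOrderType-≈ : ∀ {k} {x : Fin k → ℚ} σ τ → σ ≈ τ → HasOrderType x σ → HasOrderType x τ
hasOrderType-≈ {x = x} σ τ σ≈τ x↑ m m′ m<m′ =
  subst₂ (λ i j → x i < x j) (sym (inverse-cong σ τ σ≈τ m)) (sym (inverse-cong σ τ σ≈τ m′)) (x↑ m m′ m<m′)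

hasOrderType-< : ∀ {k} {x : Fin k → ℚ} σ → HasOrderType x σ → ∀ {i j} → σ ⟨$⟩ʳ i Fin.< σ ⟨$⟩ʳ j → x i < x j
hasOrderType-< {x = x} σ x↑ σi<σj =
  subst₂ (λ p q → x p < x q) (inverseˡ σ) (inverseˡ σ) (x↑ _ _ σi<σj)

indicator : ∀ {P : Set} → Dec P → ℕ
indicator (yes _) = 1
indicator (no _)  = 0

indicator-cong : ∀ {P Q : Set} (P? : Dec P) (Q? : Dec Q) → (P → Q) → (Q → P) → indicator P? ≡ indicator Q?
indicator-cong (yes _) (yes _) _   _   = refl
indicator-cong (yes p) (no ¬q) P→Q _   = contradiction (P→Q p) ¬q
indicator-cong (no ¬p) (yes q) _   Q→P = contradiction (Q→P q) ¬p
indicator-cong (no _)  (no _)  _   _   = refl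

indicator-no : ∀ {P : Set} (P? : Dec P) → ¬ P → indicator P? ≡ 0
indicator-no (yes p) ¬p = contradiction p ¬p
indicator-no (no _)  _  = refl

length-filter : ∀ {A : Set} {P : A → Set} (P? : ∀ x → Dec (P x)) {k} (g : Fin k → A) →
  length (filter P? (tabulate g)) ≡ sum (λ j → indicator (P? (g j)))
length-filter P? {zero}  g = refl
length-filter P? {suc k} g with P? (g zero)
... | yes _ = cong suc (length-filter P? (λ j → g (suc j)))
... | no _  = length-filter P? (λ j → g (suc j))

count-below : ∀ {k} (m : Fin k) → sum {k} (λ j → indicator (toℕ j ℕ.≤? toℕ m)) ≡ suc (toℕ m)
count-below {suc k} zero = cong suc (trans
  (sum-cong-≗ {k} (λ j → indicator-no (suc (toℕ j) ℕ.≤? 0) λ ()))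
  (sum-replicate-zero k))
count-below {suc k} (suc m) = cong suc (trans
  (sum-cong-≗ {k} (λ j → indicator-cong (suc (toℕ j) ℕ.≤? suc (toℕ m)) (toℕ j ℕ.≤? toℕ m) ℕₚ.≤-pred ℕ.s≤s))
  (count-below m))

count-below-permuted : ∀ {k} (σ : Permutation′ k) (m : Fin k) →
  sum {k} (λ j → indicator (toℕ (σ ⟨$⟩ʳ j) ℕ.≤? toℕ m)) ≡ suc (toℕ m)
count-below-permuted {k} σ m = begin
  sum {k} (λ j → below (σ ⟨$⟩ʳ j))                ≡⟨ sum-permute _ (flip σ) ⟩
  sum {k} (λ j → below (σ ⟨$⟩ʳ (σ ⟨$⟩ˡ j)))       ≡⟨ sum-cong-≗ {k} (λ j → cong below (inverseʳ σ)) ⟩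
  sum {k} (λ j → below j)                          ≡⟨ count-below m ⟩
  suc (toℕ m)                                      ∎
  where
  open ≡-Reasoning
  below : Fin k → ℕ
  below i = indicator (toℕ i ℕ.≤? toℕ m)

hasOrderType⇒pattern : ∀ {k} (x : Fin k → ℚ) σ → HasOrderType x σ → HasPattern x σ
hasOrderType⇒pattern {k} x σ x-type i = sym (begin
  length (filter (λ j → x j ≤? x i) (tabulate (λ j → j)))  ≡⟨ length-filter (λ j → x j ≤? x i) (λ j → j) ⟩
  sum {k} (λ j → indicator (x j ≤? x i))                    ≡⟨ sum-cong-≗ {k} (λ j → indicator-cong (x j ≤? x i) (σj≤?σi j) (from j) (to j)) ⟩
  sum {k} (λ j → indicator (σj≤?σi j))                      ≡⟨ count-below-permuted σ (σ ⟨$⟩ʳ i) ⟩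
  suc (toℕ (σ ⟨$⟩ʳ i))                                      ∎)
  where
  open ≡-Reasoning
  σj≤?σi : ∀ j → Dec (toℕ (σ ⟨$⟩ʳ j) ℕ.≤ toℕ (σ ⟨$⟩ʳ i))
  σj≤?σi j = toℕ (σ ⟨$⟩ʳ j) ℕ.≤? toℕ (σ ⟨$⟩ʳ i)
  from : ∀ j → x j ≤ x i → toℕ (σ ⟨$⟩ʳ j) ℕ.≤ toℕ (σ ⟨$⟩ʳ i)
  from j xj≤xi = ℕₚ.≮⇒≥ (λ σi<σj → <-irrefl refl (<-≤-trans (hasOrderType-< σ x-type σi<σj) xj≤xi))
  to : ∀ j → toℕ (σ ⟨$⟩ʳ j) ℕ.≤ toℕ (σ ⟨$⟩ʳ i) → x j ≤ x i
  to j σj≤σi with ℕₚ.m≤n⇒m<n∨m≡n σj≤σi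
  ... | inj₁ σj<σi = <⇒≤ (hasOrderType-< σ x-type σj<σi)
  ... | inj₂ σj≡σi = subst (λ l → x l ≤ x i)
    (trans (sym (inverseˡ σ)) (trans (cong (σ ⟨$⟩ˡ_) (sym (toℕ-injective σj≡σi))) (inverseˡ σ))) ≤-refl

module _ {k : ℕ} where

  transpose-left : ∀ (i j : Fin k) → PC.transpose i j i ≡ j
  transpose-left i j with i ≟ i
  ... | yes _  = refl
  ... | no i≢i = ⊥-elim (i≢i refl)

  transpose-right : ∀ (i j : Fin k) → PC.transpose i j j ≡ i
  transpose-right i j with j ≟ i
  ... | yes j≡i = j≡i
  ... | no _ with j ≟ j
  ...   | yes _  = refl
  ...   | no j≢j = ⊥-elim (j≢j refl)

  transpose-other : ∀ (i j x : Fin k) → x ≢ i → x ≢ j → PC.transpose i j x ≡ x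
  transpose-other i j x x≢i x≢j with x ≟ i
  ... | yes x≡i = ⊥-elim (x≢i x≡i)
  ... | no _ with x ≟ j
  ...   | yes x≡j = ⊥-elim (x≢j x≡j)
  ...   | no _    = refl

  transpose-unique : ∀ (σ : Permutation′ k) i j → σ ⟨$⟩ʳ i ≡ j → σ ⟨$⟩ʳ j ≡ i →
    (∀ x → x ≢ i → x ≢ j → σ ⟨$⟩ʳ x ≡ x) → σ ≈ transpose i j
  transpose-unique σ i j σi σj σx x = case x ≟ i of λ where
    (yes refl) → trans σi (sym (transpose-left i j))
    (no x≢i)   → case x ≟ j of λ where
      (yes refl) → trans σj (sym (transpose-right i j))
      (no x≢j)   → trans (σx x x≢i x≢j) (sym (transpose-other i j x x≢i x≢j))

  transpose-comm : ∀ (i j : Fin k) → transpose j i ≈ transpose i j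
  transpose-comm i j = transpose-unique (transpose j i) i j (transpose-right j i) (transpose-left j i)
    (λ x x≢i x≢j → transpose-other j i x x≢j x≢i)

  transpose-conjugate : ∀ (X : Permutation′ k) i j →
    X ∘ₚ transpose (X ⟨$⟩ʳ i) (X ⟨$⟩ʳ j) ∘ₚ flip X ≈ transpose i j
  transpose-conjugate X i j = transpose-unique (X ∘ₚ transpose Xi Xj ∘ₚ flip X) i j
    (trans (cong (X ⟨$⟩ˡ_) (transpose-left Xi Xj)) (inverseˡ X))
    (trans (cong (X ⟨$⟩ˡ_) (transpose-right Xi Xj)) (inverseˡ X))
    (λ x x≢i x≢j → trans (cong (X ⟨$⟩ˡ_) (transpose-other Xi Xj _ (x≢i ∘ X-injective) (x≢j ∘ X-injective)))
                         (inverseˡ X))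
    where
    Xi Xj : Fin k
    Xi = X ⟨$⟩ʳ i
    Xj = X ⟨$⟩ʳ j
    X-injective : ∀ {x y} → X ⟨$⟩ʳ x ≡ X ⟨$⟩ʳ y → x ≡ y
    X-injective {x} {y} eq = trans (sym (inverseˡ X)) (trans (cong (X ⟨$⟩ˡ_) eq) (inverseˡ X))

module SuffixReversal (n : ℕ) where

  open import Data.Nat using (_+_; _∸_)

  private
    reflect-bound : ∀ j (p : Fin (suc n)) → j ℕ.≤ toℕ p → j + (n ∸ toℕ p) ℕ.< suc n
    reflect-bound j p j≤p = ℕ.s≤s (begin
      j + (n ∸ toℕ p)      ≤⟨ ℕₚ.+-monoˡ-≤ (n ∸ toℕ p) j≤p ⟩
      toℕ p + (n ∸ toℕ p)  ≡⟨ ℕₚ.m+[n∸m]≡n (ℕₚ.≤-pred (toℕ<n p)) ⟩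
      n                    ∎)
      where open ℕₚ.≤-Reasoning

  -- The suffix reversal at j fixes the positions below j and reverses the block of
  -- positions j, …, n.  It is kept opaque: only its two defining equations are used.
  opaque
    reflect : ℕ → Fin (suc n) → Fin (suc n)
    reflect j p with toℕ p ℕₚ.<? j
    ... | yes _   = p
    ... | no p≮j = fromℕ< (reflect-bound j p (ℕₚ.≮⇒≥ p≮j))

    reflect-below : ∀ j p → toℕ p ℕ.< j → reflect j p ≡ p
    reflect-below j p p<j with toℕ p ℕₚ.<? j
    ... | yes _   = refl
    ... | no p≮j = ⊥-elim (p≮j p<j)

    reflect-above : ∀ j p → j ℕ.≤ toℕ p → toℕ (reflect j p) ≡ j + (n ∸ toℕ p)
    reflect-above j p j≤p with toℕ p ℕₚ.<? j
    ... | yes p<j = ⊥-elim (ℕₚ.<⇒≱ p<j j≤p)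
    ... | no _    = toℕ-fromℕ< _

  reflect-stays-above : ∀ j p → j ℕ.≤ toℕ p → j ℕ.≤ toℕ (reflect j p)
  reflect-stays-above j p j≤p = subst (j ℕ.≤_) (sym (reflect-above j p j≤p)) (ℕₚ.m≤m+n j _)

  reflect-reverses : ∀ j p q → j ℕ.≤ toℕ p → p Fin.< q → reflect j q Fin.< reflect j p
  reflect-reverses j p q j≤p p<q = subst₂ ℕ._<_
    (sym (reflect-above j q (ℕₚ.≤-trans j≤p (ℕₚ.<⇒≤ p<q)))) (sym (reflect-above j p j≤p))
    (ℕₚ.+-monoʳ-< j (ℕₚ.∸-monoʳ-< p<q (ℕₚ.≤-pred (toℕ<n q))))

  reflect-involutive-above : ∀ j p → j ℕ.≤ toℕ p → reflect j (reflect j p) ≡ p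
  reflect-involutive-above j p j≤p = toℕ-injective (begin
    toℕ (reflect j (reflect j p))  ≡⟨ reflect-above j _ (reflect-stays-above j p j≤p) ⟩
    j + (n ∸ toℕ (reflect j p))    ≡⟨ cong (λ v → j + (n ∸ v)) (reflect-above j p j≤p) ⟩
    j + (n ∸ (j + (n ∸ toℕ p)))    ≡⟨ cong (λ v → j + (n ∸ v)) (ℕₚ.+-comm j (n ∸ toℕ p)) ⟩
    j + (n ∸ ((n ∸ toℕ p) + j))    ≡⟨ cong (j +_) (ℕₚ.∸-+-assoc n (n ∸ toℕ p) j) ⟨
    j + ((n ∸ (n ∸ toℕ p)) ∸ j)    ≡⟨ cong (λ v → j + (v ∸ j)) (ℕₚ.m∸[m∸n]≡n (ℕₚ.≤-pred (toℕ<n p))) ⟩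
    j + (toℕ p ∸ j)                ≡⟨ ℕₚ.m+[n∸m]≡n j≤p ⟩
    toℕ p                          ∎)
    where open ≡-Reasoning

  reflect-involutive : ∀ j p → reflect j (reflect j p) ≡ p
  reflect-involutive j p = case toℕ p ℕₚ.<? j of λ where
    (yes p<j) → trans (cong (reflect j) (reflect-below j p p<j)) (reflect-below j p p<j)
    (no p≮j)  → reflect-involutive-above j p (ℕₚ.≮⇒≥ p≮j)

  suffixReversal : ℕ → Permutation′ (suc n)
  suffixReversal j = permutation (reflect j) (reflect j) (reflect-involutive j) (reflect-involutive j)

  reflect-above-at : ∀ j p {v} → toℕ p ≡ v → j ℕ.≤ v → toℕ (reflect j p) ≡ j + (n ∸ v)
  reflect-above-at j p refl j≤v = reflect-above j p j≤v

  reflect-below-at : ∀ j p {v} → toℕ p ≡ v → v ℕ.< j → toℕ (reflect j p) ≡ v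
  reflect-below-at j p refl v<j = cong toℕ (reflect-below j p v<j)

  last-two-swap : ∀ (a b : Fin (suc n)) → 1 ℕ.≤ n → toℕ a ≡ n ∸ 1 → toℕ b ≡ n →
    suffixReversal (n ∸ 1) ≈ transpose a b
  last-two-swap a b 1≤n a≡n-1 b≡n = transpose-unique (suffixReversal (n ∸ 1)) a b
    (toℕ-injective (begin
      toℕ (reflect (n ∸ 1) a)  ≡⟨ reflect-above-at (n ∸ 1) a a≡n-1 ℕₚ.≤-refl ⟩
      n ∸ 1 + (n ∸ (n ∸ 1))    ≡⟨ cong (n ∸ 1 +_) (ℕₚ.m∸[m∸n]≡n 1≤n) ⟩
      n ∸ 1 + 1                ≡⟨ ℕₚ.m∸n+n≡m 1≤n ⟩
      n                        ≡⟨ b≡n ⟨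
      toℕ b                    ∎))
    (toℕ-injective (begin
      toℕ (reflect (n ∸ 1) b)  ≡⟨ reflect-above-at (n ∸ 1) b b≡n (ℕₚ.m∸n≤m n 1) ⟩
      n ∸ 1 + (n ∸ n)          ≡⟨ cong (n ∸ 1 +_) (ℕₚ.n∸n≡0 n) ⟩
      n ∸ 1 + 0                ≡⟨ ℕₚ.+-identityʳ (n ∸ 1) ⟩
      n ∸ 1                    ≡⟨ a≡n-1 ⟨
      toℕ a                    ∎))
    (λ x x≢a x≢b → reflect-below (n ∸ 1) x (below-last-two x x≢a x≢b))
    where
    open ≡-Reasoning
    below-last-two : ∀ x → x ≢ a → x ≢ b → toℕ x ℕ.< n ∸ 1
    below-last-two x x≢a x≢b = ℕₚ.≤∧≢⇒< (ℕₚ.<⇒≤pred x<n) (λ eq → x≢a (toℕ-injective (trans eq (sym a≡n-1))))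
      where
      x<n : toℕ x ℕ.< n
      x<n = ℕₚ.≤∧≢⇒< (ℕₚ.≤-pred (toℕ<n x)) (λ eq → x≢b (toℕ-injective (trans eq (sym b≡n))))

  gather : Fin (suc n) → Fin (suc n) → Permutation′ (suc n)
  gather i j = suffixReversal (toℕ i) ∘ₚ suffixReversal (suc m) ∘ₚ suffixReversal m
    where
    m : ℕ
    m = toℕ i + (n ∸ toℕ j)

  module _ {i j : Fin (suc n)} (i<j : i Fin.< j) where
    private
      m : ℕ
      m = toℕ i + (n ∸ toℕ j)
      j≤n : toℕ j ℕ.≤ n
      j≤n = ℕₚ.≤-pred (toℕ<n j)
      m<n : m ℕ.< n
      m<n = begin-strict
        toℕ i + (n ∸ toℕ j)  <⟨ ℕₚ.+-monoˡ-< (n ∸ toℕ j) i<j ⟩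
        toℕ j + (n ∸ toℕ j)  ≡⟨ ℕₚ.m+[n∸m]≡n j≤n ⟩
        n                    ∎
        where open ℕₚ.≤-Reasoning

    gather-left : toℕ (gather i j ⟨$⟩ʳ i) ≡ n ∸ 1
    gather-left = begin
      toℕ (reflect m (reflect (suc m) (reflect (toℕ i) i)))  ≡⟨ reflect-above-at m _ step₂ (ℕₚ.n≤1+n m) ⟩
      m + (n ∸ suc m)                                        ≡⟨ cong (m +_) (ℕₚ.∸-+-assoc n 1 m) ⟨
      m + (n ∸ 1 ∸ m)                                        ≡⟨ ℕₚ.m+[n∸m]≡n (ℕₚ.<⇒≤pred m<n) ⟩
      n ∸ 1                                                  ∎
      where
      open ≡-Reasoning
      step₁ : toℕ (reflect (toℕ i) i) ≡ n
      step₁ = trans (reflect-above (toℕ i) i ℕₚ.≤-refl) (ℕₚ.m+[n∸m]≡n (ℕₚ.≤-trans (ℕₚ.<⇒≤ i<j) j≤n))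
      step₂ : toℕ (reflect (suc m) (reflect (toℕ i) i)) ≡ suc m
      step₂ = trans (reflect-above-at (suc m) _ step₁ m<n)
                (trans (cong (suc m +_) (ℕₚ.n∸n≡0 n)) (ℕₚ.+-identityʳ (suc m)))

    gather-right : toℕ (gather i j ⟨$⟩ʳ j) ≡ n
    gather-right = trans (reflect-above-at m _ step₂ ℕₚ.≤-refl) (ℕₚ.m+[n∸m]≡n (ℕₚ.<⇒≤ m<n))
      where
      step₁ : toℕ (reflect (toℕ i) j) ≡ m
      step₁ = reflect-above (toℕ i) j (ℕₚ.<⇒≤ i<j)
      step₂ : toℕ (reflect (suc m) (reflect (toℕ i) j)) ≡ m
      step₂ = reflect-below-at (suc m) _ step₁ (ℕₚ.n<1+n m)

    transpose-via-reflections : gather i j ∘ₚ suffixReversal (n ∸ 1) ∘ₚ flip (gather i j) ≈ transpose i j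
    transpose-via-reflections x = trans
      (cong (X ⟨$⟩ˡ_) (last-two-swap (X ⟨$⟩ʳ i) (X ⟨$⟩ʳ j) 1≤n gather-left gather-right (X ⟨$⟩ʳ x)))
      (transpose-conjugate X i j x)
      where
      X : Permutation′ (suc n)
      X = gather i j
      1≤n : 1 ℕ.≤ n
      1≤n = ℕₚ.<-≤-trans (ℕₚ.≤-<-trans ℕ.z≤n i<j) j≤n

-- Any class of permutations of Fin (suc n) closed under the group operations
-- and containing all suffix reversals contains every permutation: it contains
-- every transposition by the conjugation above, and transpositions generate.
module Generate (n : ℕ) (P : Permutation′ (suc n) → Set)
  (P-≈ : ∀ σ τ → σ ≈ τ → P σ → P τ)
  (P-id : P id)
  (P-∘ : ∀ σ τ → P σ → P τ → P (σ ∘ₚ τ))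
  (P-flip : ∀ σ → P σ → P (flip σ))
  (P-reflection : ∀ j → P (SuffixReversal.suffixReversal n j)) where

  open import Data.Nat using (_∸_)

  open SuffixReversal n

  P-gather : ∀ i j → P (gather i j)
  P-gather i j = P-∘ _ _ (P-reflection _) (P-∘ _ _ (P-reflection _) (P-reflection _))

  P-ordered-transpose : ∀ {i j} → i Fin.< j → P (transpose i j)
  P-ordered-transpose {i} {j} i<j = P-≈ _ _ (transpose-via-reflections i<j)
    (P-∘ _ _ (P-gather i j) (P-∘ _ _ (P-reflection (n ∸ 1)) (P-flip _ (P-gather i j))))

  P-transpose : ∀ i j → P (transpose i j)
  P-transpose i j with <-cmp i j
  ... | tri< i<j _ _  = P-ordered-transpose i<j
  ... | tri≈ _ refl _ = P-≈ id _ (transpose-unique id i i refl refl (λ _ _ _ → refl)) P-id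
  ... | tri> _ _ j<i  = P-≈ _ _ (transpose-comm i j) (P-ordered-transpose j<i)

  P-eval : ∀ xs → P (eval xs)
  P-eval []             = P-id
  P-eval ((i , j) ∷ xs) = P-∘ _ _ (P-transpose i j) (P-eval xs)

  everything : ∀ σ → P σ
  everything σ = P-≈ _ _ (eval-decompose σ) (P-eval (decompose σ))

module Attainability (f : PermQ) (n : ℕ) where

  Tuple : Set
  Tuple = Fin (suc n) → ℚ

  Accessible : Tuple → Set
  Accessible e = ∀ c → StrictlyIncreasing c → Σ PermQ λ g → InΓ f g × Carries g c e

  Attainable : Permutation′ (suc n) → Set
  Attainable σ = ∀ c → StrictlyIncreasing c → Σ PermQ λ g → InΓ f g × HasOrderType (λ i → app g (c i)) σ

  accessible-ascending : ∀ e → StrictlyIncreasing e → Accessible e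
  accessible-ascending e e↑ c c↑ with shift-between ascending c e c↑ e↑
  ... | s , s↑ , s-carries = s , shift s s↑ , s-carries

  attainable-via : ∀ e g σ → Accessible e → InΓ f g → HasOrderType (λ i → app g (e i)) σ → Attainable σ
  attainable-via e g σ e-acc g∈Γ ge-type c c↑ with e-acc c c↑
  ... | h , h∈Γ , h-carries = g ↔-∘ h , comp g∈Γ h∈Γ ,
    hasOrderType-cong σ (λ i → cong (app g) (sym (h-carries i))) ge-type

  attainable-≈ : ∀ σ τ → σ ≈ τ → Attainable σ → Attainable τ
  attainable-≈ σ τ σ≈τ σ-att c c↑ with σ-att c c↑
  ... | g , g∈Γ , type = g , g∈Γ , hasOrderType-≈ {x = λ i → app g (c i)} σ τ σ≈τ type

  attainable-id : Attainable id
  attainable-id c c↑ = ↔-id ℚ , idp , c↑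

  -- Sort the image of c by σ, then apply the element attaining τ to the sorted tuple.
  attainable-∘ : ∀ σ τ → Attainable σ → Attainable τ → Attainable (σ ∘ₚ τ)
  attainable-∘ σ τ σ-att τ-att c c↑ with σ-att c c↑
  ... | g , g∈Γ , sorted with τ-att (λ m → app g (c (σ ⟨$⟩ˡ m))) sorted
  ...   | h , h∈Γ , type = h ↔-∘ g , comp h∈Γ g∈Γ , type

  -- Shift c onto the sorted image of c, then undo the element attaining σ.
  attainable-flip : ∀ σ → Attainable σ → Attainable (flip σ)
  attainable-flip σ σ-att c c↑ with σ-att c c↑
  ... | g , g∈Γ , sorted with accessible-ascending (λ m → app g (c (σ ⟨$⟩ˡ m))) sorted c c↑
  ...   | h , h∈Γ , h-carries = ↔-sym g ↔-∘ h , comp (inv g∈Γ) h∈Γ ,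
    hasOrderType-cong (flip σ) unsort c∘σ⁻¹-type
    where
    c∘σ⁻¹-type : HasOrderType (λ m → c (σ ⟨$⟩ˡ m)) (flip σ)
    c∘σ⁻¹-type m m′ m<m′ = subst₂ (λ p q → c p < c q) (sym (inverseˡ σ)) (sym (inverseˡ σ)) (c↑ m m′ m<m′)
    unsort : ∀ m → c (σ ⟨$⟩ˡ m) ≡ Inverse.from g (app h (c m))
    unsort m = sym (trans (cong (Inverse.from g) (h-carries m)) (Inverse.strictlyInverseʳ g _))

  attainable⇒realizes : ∀ c → StrictlyIncreasing c → ∀ σ → Attainable σ → Realizes (InΓ f) σ
  attainable⇒realizes c c↑ σ σ-att with σ-att c c↑
  ... | g , g∈Γ , type = g , g∈Γ , c , c↑ , hasOrderType⇒pattern (λ i → app g (c i)) σ type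

-- From here on f reverses some increasing tuple b.  This gives Γ_f access to
-- every monotone tuple, and makes the reversal of all positions attainable.
module Reversing (f : PermQ) (n : ℕ) (b : Fin (suc n) → ℚ)
  (b↑ : StrictlyIncreasing b) (fb↓ : StrictlyDecreasing (λ i → app f (b i))) where

  open Attainability f n
  open SuffixReversal n

  -- A descending tuple is reached by shifting onto b, applying f, and shifting again.
  accessible-monotone : ∀ d e → Monotone d e → Accessible e
  accessible-monotone ascending  e e↑ = accessible-ascending e e↑
  accessible-monotone descending e e↓ c c↑
    with shift-between ascending c b c↑ b↑ | shift-between descending (λ i → app f (b i)) e fb↓ e↓
  ... | s , s↑ , s-carries | t , t↑ , t-carries =
    t ↔-∘ (f ↔-∘ s) , comp (shift t t↑) (comp gen (shift s s↑)) ,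
    λ i → trans (cong (λ x → app t (app f x)) (s-carries i)) (t-carries i)

  attainable-reverse : Attainable reverse
  attainable-reverse = attainable-via b f reverse (accessible-ascending b b↑) gen (monotone-backwards descending fb↓)

  -- If g sends an accessible tuple e to a tuple that is monotone once sorted by σ,
  -- then σ is attainable (in the descending case compose with the reversal).
  attainable-via-monotone : ∀ d e g σ → Accessible e → InΓ f g →
    Monotone d (λ m → app g (e (σ ⟨$⟩ˡ m))) → Attainable σ
  attainable-via-monotone ascending  e g σ e-acc g∈Γ sorted = attainable-via e g σ e-acc g∈Γ sorted
  attainable-via-monotone descending e g σ e-acc g∈Γ sorted =
    attainable-≈ ((σ ∘ₚ reverse) ∘ₚ reverse) σ (λ i → opposite-involutive (σ ⟨$⟩ʳ i))
      (attainable-∘ (σ ∘ₚ reverse) reverse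
        (attainable-via e g (σ ∘ₚ reverse) e-acc g∈Γ (monotone-backwards descending sorted))
        attainable-reverse)

  attainable-from-blocks : ∀ d d′ j g (u v : Tuple) → InΓ f g →
    Monotone d u → Monotone d v → (∀ p q → Ordered d (u p) (v q)) →
    Monotone d′ (λ i → app g (u i)) → Monotone (turn d′) (λ i → app g (v i)) →
    (∀ p q → Ordered d′ (app g (u p)) (app g (v q))) →
    Attainable (suffixReversal j)
  attainable-from-blocks d d′ j g u v g∈Γ u↗ v↗ u↗v gu↗ gv↘ gu↗gv =
    attainable-via-monotone d′ e g (suffixReversal j)
      (accessible-monotone d e (monotone-splice d j u↗ v↗ u↗v)) g∈Γ
      (monotone-by-cut d′ j (λ m → app g (e (reflect j m))) below across above)
    where
    e : Tuple
    e = splice j u v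
    e-below : ∀ {p} → toℕ p ℕ.< j → app g (e (reflect j p)) ≡ app g (u p)
    e-below {p} p<j = cong (app g) (trans (cong e (reflect-below j p p<j)) (splice-below j u v p<j))
    e-above : ∀ {p} → j ℕ.≤ toℕ p → app g (e (reflect j p)) ≡ app g (v (reflect j p))
    e-above {p} j≤p = cong (app g) (splice-above j u v (reflect-stays-above j p j≤p))
    below : ∀ p q → p Fin.< q → toℕ q ℕ.< j → Ordered d′ (app g (e (reflect j p))) (app g (e (reflect j q)))
    below p q p<q q<j = subst₂ (Ordered d′) (sym (e-below (ℕₚ.<-trans p<q q<j))) (sym (e-below q<j)) (gu↗ p q p<q)
    across : ∀ p q → toℕ p ℕ.< j → j ℕ.≤ toℕ q → Ordered d′ (app g (e (reflect j p))) (app g (e (reflect j q)))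
    across p q p<j j≤q = subst₂ (Ordered d′) (sym (e-below p<j)) (sym (e-above j≤q)) (gu↗gv p (reflect j q))
    above : ∀ p q → p Fin.< q → j ℕ.≤ toℕ p → Ordered d′ (app g (e (reflect j p))) (app g (e (reflect j q)))
    above p q p<q j≤p = subst₂ (Ordered d′) (sym (e-above j≤p)) (sym (e-above (ℕₚ.≤-trans j≤p (ℕₚ.<⇒≤ p<q))))
      (ordered-turn d′ (gv↘ _ _ (reflect-reverses j p q j≤p p<q)))

  -- The four possible arrangements of the blocks a, b and of their images are all
  -- instances of the two-block lemma (reading a and b backwards where needed).
  suffixReversal-attainable : ∀ (a : Tuple) → StrictlyIncreasing a → StrictlyIncreasing (λ i → app f (a i)) →
    (∀ p q → a p < b q) ⊎ (∀ p q → b q < a p) →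
    (∀ p q → app f (a p) < app f (b q)) ⊎ (∀ p q → app f (b q) < app f (a p)) →
    ∀ j → Attainable (suffixReversal j)
  suffixReversal-attainable a a↑ fa↑ (inj₁ a<b) (inj₁ fa<fb) j =
    attainable-from-blocks ascending ascending j f a b gen a↑ b↑ a<b fa↑ fb↓ fa<fb
  suffixReversal-attainable a a↑ fa↑ (inj₂ b<a) (inj₁ fa<fb) j =
    attainable-from-blocks ascending descending j f b a gen b↑ a↑ (λ p q → b<a q p) fb↓ fa↑ (λ p q → fa<fb q p)
  suffixReversal-attainable a a↑ fa↑ (inj₁ a<b) (inj₂ fb<fa) j =
    attainable-from-blocks descending ascending j f (λ i → b (opposite i)) (λ i → a (opposite i)) gen
      (monotone-backwards ascending b↑) (monotone-backwards ascending a↑) (λ p q → a<b (opposite q) (opposite p))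
      (monotone-backwards descending fb↓) (monotone-backwards ascending fa↑) (λ p q → fb<fa (opposite q) (opposite p))
  suffixReversal-attainable a a↑ fa↑ (inj₂ b<a) (inj₂ fb<fa) j =
    attainable-from-blocks descending descending j f (λ i → a (opposite i)) (λ i → b (opposite i)) gen
      (monotone-backwards ascending a↑) (monotone-backwards ascending b↑) (λ p q → b<a (opposite p) (opposite q))
      (monotone-backwards ascending fa↑) (monotone-backwards descending fb↓) (λ p q → fb<fa (opposite p) (opposite q))

lemma3 : (f : PermQ) (n : ℕ) (a b : Fin (suc n) → ℚ)
    → StrictlyIncreasing a → StrictlyIncreasing b
    → StrictlyIncreasing (λ i → app f (a i))
    → StrictlyDecreasing (λ i → app f (b i))
    → DisjointIntervals (a zero) (a (fromℕ n)) (b zero) (b (fromℕ n))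
    → DisjointIntervals (app f (a zero)) (app f (a (fromℕ n))) (app f (b (fromℕ n))) (app f (b zero))
    → KTrivial (suc n) f
lemma3 f n a b a↑ b↑ fa↑ fb↓ domains-disjoint images-disjoint σ =
  attainable⇒realizes a a↑ σ (all-attainable σ)
  where
  open Attainability f n
  open Reversing f n b b↑ fb↓
  blocks-separated : (∀ p q → a p < b q) ⊎ (∀ p q → b q < a p)
  blocks-separated = separated (ascending-within a↑) (ascending-within b↑) domains-disjoint
  images-separated : (∀ p q → app f (a p) < app f (b q)) ⊎ (∀ p q → app f (b q) < app f (a p))
  images-separated = separated (ascending-within fa↑) (descending-within fb↓) images-disjoint
  all-attainable : ∀ σ → Attainable σ
  all-attainable = Generate.everything n Attainable attainable-≈ attainable-id attainable-∘ attainable-flip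
    (suffixReversal-attainable a a↑ fa↑ blocks-separated images-separated)
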